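{- Let $q_1\xrightarrow{g;R}q_2$ be a transition of a timed automaton, where the guard $g$ is written as $g=g_L\wedge g_U$ with $g_L$ the conjunction of the lower-bound atomic constraints of $g$ and $g_U$ the conjunction of the upper-bound atomic constraints of $g$. Consider the automaton in which this transition is replaced by two transitions $q_1\xrightarrow{g_L;\emptyset}q_1'$ and $q_1'\xrightarrow{g_U;R}q_2$ through a fresh state $q_1'$. Let $W_1$ be a set of valuations closed under time elapse (i.e. $v\in W_1$ implies $v+\delta\in W_1$ for all $\delta\ge0$). If $(q_1,W_1)\Rightarrow_{g;R}(q_2,W_2)$ and $(q_1,W_1)\Rightarrow_{g_L}(q_1',W_1')\Rightarrow_{g_U;R}(q_2,W_2')$, then $W_2=W_2'$.
   Context: Clocks form a finite set $X$; valuations are maps $v:X\to\mathbb{R}_{\ge0}$; $v+\delta$ adds $\delta$ to every clock; $[R]v$ resets the clocks of $R\subseteq X$ to $0$. A guard is a conjunction of atomic constraints $x\,\#\,c$ with $c\in\mathbb{N}$; a lower-bound constraint is one of the form $x>c$ or $x\ge c$, an upper-bound constraint one of the form $x<c$ or $x\le c$. For a transition $t=(q,g,R,q')$, the action move is $(q,v)\to^{t}(q',[R]v)$ when $v\models g$, and delay moves are $(q,v)\to^{\delta}(q,v+\delta)$. For a set of valuations $W$, $(q,W)\Rightarrow_t(q',W')$ where $W'=\{v' : \exists v\in W,\ \exists\delta\ge0,\ (q,v)\to^{t}\to^{\delta}(q',v')\}$ (so $\Rightarrow_{g;R}$ denotes this symbolic step along a transition with guard $g$ and reset $R$, and $\Rightarrow_{g_L}$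 along a transition with guard $g_L$ and no reset). -}

module Defs where

open import Data.Nat using (ℕ)
open import Data.Fin using (Fin)
open import Data.Fin.Subset using (Subset)
open import Data.Vec using (lookup)
open import Data.Bool using (Bool; true; false; if_then_else_)
open import Data.List using (List; []; _∷_; filter)
open import Data.List.Relation.Unary.All using (All)
open import Data.Product using (Σ; _×_; ∃)
open import Relation.Binary.PropositionalEquality using (_≡_; _≢_)
open import Relation.Binary.Structures using (IsTotalOrder)
open import Algebra.Structures using (IsCommutativeMonoid)
open import Relation.Nullary using (Dec; yes; no)
open import Relation.Unary using (Pred; Decidable)
open import Function.Bundles using (_⇔_)
import Level

-- Abstract time domain standing for ℝ≥0 (the stdlib has no reals).
-- Every axiom below holds for the non-negative reals.
record TimeDomain : Set₁ where
  field
    T       : Set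
    _≤_     : T → T → Set
    _+_     : T → T → T
    0#      : T
    ⟦_⟧     : ℕ → T
    isTotalOrder        : IsTotalOrder _≡_ _≤_
    isCommutativeMonoid : IsCommutativeMonoid _≡_ _+_ 0#
    0-least  : ∀ a → 0# ≤ a
    +-monoˡ  : ∀ {a b} c → a ≤ b → (a + c) ≤ (b + c)

  _<_ : T → T → Set
  a < b = (a ≤ b) × (a ≢ b)

data Op : Set where
  lt le ge gt : Op

isLower : Op → Bool
isLower lt = false
isLower le = false
isLower ge = true
isLower gt = true

isUpper : Op → Bool
isUpper lt = true
isUpper le = true
isUpper ge = false
isUpper gt = false

record Atom (n : ℕ) : Set where
  constructor atom
  field
    clock : Fin n
    op    : Op
    const : ℕ

Guard : ℕ → Set
Guard n = List (Atom n)

isLowerAtom : ∀ {n} → Atom n → Bool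
isLowerAtom (atom _ o _) = isLower o

isUpperAtom : ∀ {n} → Atom n → Bool
isUpperAtom (atom _ o _) = isUpper o

boolDec : (b : Bool) → Dec (b ≡ true)
boolDec true  = yes _≡_.refl
boolDec false = no (λ ())

lowerPart : ∀ {n} → Guard n → Guard n
lowerPart = filter (λ a → boolDec (isLowerAtom a))

upperPart : ∀ {n} → Guard n → Guard n
upperPart = filter (λ a → boolDec (isUpperAtom a))

module _ (D : TimeDomain) where
  open TimeDomain D

  Val : ℕ → Set
  Val n = Fin n → T

  delay : ∀ {n} → Val n → T → Val n
  delay v δ x = v x + δ

  reset : ∀ {n} → Subset n → Val n → Val n
  reset R v x = if lookup R x then 0# else v x

  satOp : T → Op → T → Set
  satOp a lt c = a < c
  satOp a le c = a ≤ c
  satOp a ge c = c ≤ a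
  satOp a gt c = c < a

  _⊨ₐ_ : ∀ {n} → Val n → Atom n → Set
  v ⊨ₐ atom x o c = satOp (v x) o ⟦ c ⟧

  _⊨_ : ∀ {n} → Val n → Guard n → Set
  v ⊨ g = All (v ⊨ₐ_) g

  TimeClosed : ∀ {n} → Pred (Val n) Level.zero → Set
  TimeClosed W = ∀ v δ → W v → W (delay v δ)

  Post : ∀ {n} → Guard n → Subset n → Pred (Val n) Level.zero → Pred (Val n) Level.zero
  Post {n} g R W v' = Σ (Val n) λ v → Σ T λ δ →
    W v × (v ⊨ g) × (∀ x → v' x ≡ delay (reset R v) δ x)

-- Splitting the guard only changes the order in which its atoms are checked. Lower bounds
-- x ≥ c, x > c stay true as time elapses, so checking g_L and then letting time δ pass
-- before checking g_U amounts to checking all of g at the delayed valuation v + δ; and v + δ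
-- still lies in W₁ because W₁ is closed under time elapse. Conversely a run that checks g
-- at v is a split run that waits 0 between the two halves.
module Submission where

open import Defs
open import Data.Nat using (ℕ)
open import Data.Fin.Subset using (Subset; ⊥)
open import Data.Bool using (true; false)
open import Data.List using ([]; _∷_)
open import Data.List.Relation.Unary.All as All using ([]; _∷_)
open import Data.List.Relation.Unary.All.Properties using (all-filter; filter⁺)
open import Data.Vec using (lookup)
open import Data.Vec.Properties using (lookup-replicate)
open import Data.Product using (_,_)
open import Function.Bundles using (_⇔_; mk⇔; Equivalence)
import Function.Properties.Equivalence as ⇔
open import Relation.Binary.PropositionalEquality
open import Relation.Binary.Structures using (IsTotalOrder)
open import Relation.Unary using (Pred; _⊆_)
open import Algebra.Structures using (IsCommutativeMonoid)
open import Level using (0ℓ)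

module _ (D : TimeDomain) where
  open TimeDomain D
  open IsTotalOrder isTotalOrder using (antisym) renaming (trans to ≤-trans)
  open IsCommutativeMonoid isCommutativeMonoid using (identityˡ; identityʳ; comm)

  a≤a+d : ∀ a d → a ≤ (a + d)
  a≤a+d a d = subst₂ _≤_ (identityˡ a) (comm d a) (+-monoˡ a (0-least d))

  delay-identity : ∀ {n} (v : Val D n) → delay D v 0# ≗ v
  delay-identity v x = identityʳ (v x)

  reset-⊥ : ∀ {n} (v : Val D n) → reset D ⊥ v ≗ v
  reset-⊥ v x rewrite lookup-replicate x false = refl

  reset-cong : ∀ {n} (R : Subset n) {u v : Val D n} → u ≗ v → reset D R u ≗ reset D R v
  reset-cong R u≗v x with lookup R x
  ... | true  = refl
  ... | false = u≗v x

  ⊨-cong : ∀ {n} {u v : Val D n} (g : Guard n) → u ≗ v → _⊨_ D u g → _⊨_ D v g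
  ⊨-cong g u≗v = All.map λ { {atom x o c} → subst (λ t → satOp D t o ⟦ c ⟧) (u≗v x) }

  delay-preserves-⊨ₐ-lower : ∀ {n} (v : Val D n) d (a : Atom n) → isLowerAtom a ≡ true →
                             _⊨ₐ_ D v a → _⊨ₐ_ D (delay D v d) a
  delay-preserves-⊨ₐ-lower v d (atom x lt c) () _
  delay-preserves-⊨ₐ-lower v d (atom x le c) () _
  delay-preserves-⊨ₐ-lower v d (atom x ge c) _ c≤vx = ≤-trans c≤vx (a≤a+d (v x) d)
  delay-preserves-⊨ₐ-lower v d (atom x gt c) _ (c≤vx , c≢vx) =
    ≤-trans c≤vx (a≤a+d (v x) d) ,
    λ c≡vx+d → c≢vx (antisym c≤vx (subst (v x ≤_) (sym c≡vx+d) (a≤a+d (v x) d)))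

  delay-preserves-⊨-lowerPart : ∀ {n} (v : Val D n) d (g : Guard n) →
                                _⊨_ D v (lowerPart g) → _⊨_ D (delay D v d) (lowerPart g)
  delay-preserves-⊨-lowerPart v d g v⊨gL =
    All.zipWith (λ { (lower , sat) → delay-preserves-⊨ₐ-lower v d _ lower sat })
                (all-filter _ g , v⊨gL)

  ⊨-lowerPart-upperPart : ∀ {n} (v : Val D n) (g : Guard n) →
                          _⊨_ D v (lowerPart g) → _⊨_ D v (upperPart g) → _⊨_ D v g
  ⊨-lowerPart-upperPart v []                _        _        = []
  ⊨-lowerPart-upperPart v (atom x lt c ∷ g) gL       (s ∷ gU) = s ∷ ⊨-lowerPart-upperPart v g gL gU
  ⊨-lowerPart-upperPart v (atom x le c ∷ g) gL       (s ∷ gU) = s ∷ ⊨-lowerPart-upperPart v g gL gU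
  ⊨-lowerPart-upperPart v (atom x ge c ∷ g) (s ∷ gL) gU       = s ∷ ⊨-lowerPart-upperPart v g gL gU
  ⊨-lowerPart-upperPart v (atom x gt c ∷ g) (s ∷ gL) gU       = s ∷ ⊨-lowerPart-upperPart v g gL gU

  Post-mono : ∀ {n} (g : Guard n) (R : Subset n) {W W′ : Pred (Val D n) 0ℓ} →
              W ⊆ W′ → Post D g R W ⊆ Post D g R W′
  Post-mono g R W⊆W′ (v , δ , v∈W , rest) = v , δ , W⊆W′ v∈W , rest

  Post-split : ∀ {n} (g : Guard n) (R : Subset n) (W : Pred (Val D n) 0ℓ) → TimeClosed D W →
               ∀ v′ → Post D g R W v′ ⇔ Post D (upperPart g) R (Post D (lowerPart g) ⊥ W) v′
  Post-split g R W closed v′ = mk⇔ split merge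
    where
    split : Post D g R W v′ → Post D (upperPart g) R (Post D (lowerPart g) ⊥ W) v′
    split (v , δ , v∈W , v⊨g , v′≗) =
      v , δ ,
      (v , 0# , v∈W , filter⁺ _ v⊨g ,
       λ x → sym (trans (delay-identity (reset D ⊥ v) x) (reset-⊥ v x))) ,
      filter⁺ _ v⊨g , v′≗

    merge : Post D (upperPart g) R (Post D (lowerPart g) ⊥ W) v′ → Post D g R W v′
    merge (u , δ , (w , δ₀ , w∈W , w⊨gL , u≗) , u⊨gU , v′≗) =
      delay D w δ₀ , δ , closed w δ₀ w∈W ,
      ⊨-lowerPart-upperPart (delay D w δ₀) g
        (delay-preserves-⊨-lowerPart w δ₀ g w⊨gL) (⊨-cong (upperPart g) u≗w+δ₀ u⊨gU) ,
      λ x → trans (v′≗ x) (cong (_+ δ) (reset-cong R u≗w+δ₀ x))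
      where
      u≗w+δ₀ : u ≗ delay D w δ₀
      u≗w+δ₀ x = trans (u≗ x) (cong (_+ δ₀) (reset-⊥ w x))

lemma2 : (D : TimeDomain) (n : ℕ) (g : Guard n) (R : Subset n)
    (W₁ W₂ W₁′ W₂′ : Val D n → Set) →
    TimeClosed D W₁ →
    (∀ v → W₂ v ⇔ Post D g R W₁ v) →
    (∀ v → W₁′ v ⇔ Post D (lowerPart g) ⊥ W₁ v) →
    (∀ v → W₂′ v ⇔ Post D (upperPart g) R W₁′ v) →
    ∀ v → W₂ v ⇔ W₂′ v
lemma2 D n g R W₁ W₂ W₁′ W₂′ closed W₂≐ W₁′≐ W₂′≐ v =
  ⇔.trans (W₂≐ v) (⇔.trans (Post-split D g R W₁ closed v) (⇔.sym (⇔.trans (W₂′≐ v) W₂′-via-W₁)))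
  where
  W₂′-via-W₁ : Post D (upperPart g) R W₁′ v ⇔ Post D (upperPart g) R (Post D (lowerPart g) ⊥ W₁) v
  W₂′-via-W₁ = mk⇔ (Post-mono D (upperPart g) R (Equivalence.to (W₁′≐ _)))
                   (Post-mono D (upperPart g) R (Equivalence.from (W₁′≐ _)))
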